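{- Let $G$ be a graph, and let $S := \{x\in V(G) \mid \alpha(G[N_G(x)])\ge 3\}$, the set of vertices of $G$ that have three pairwise nonadjacent neighbors. If $S$ is a clique, then $G$ is $T_0$-free.
   Context: All graphs are finite, simple and nonnull. $\alpha$ denotes the stability number (maximum size of a set of pairwise nonadjacent vertices), $N_G(x)$ the set of neighbors of $x$, and $G[X]$ the induced subgraph on $X$. A clique is a set of pairwise adjacent vertices. $T_0$ is the graph with vertex set $\{p,p',q_0,q_1,q_2,q_3,r_1,r_2,r_3\}$ and exactly the edges $pp',pq_0,pq_2,pq_3,p'q_1,p'q_2,p'q_3,q_0r_1,q_1r_1,q_2r_2,q_3r_3,r_1r_2,r_1r_3,r_2r_3$; $G$ is $T_0$-free if no induced subgraph of $G$ is isomorphic to $T_0$. -}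

module Defs where

open import Data.Nat using (ℕ)
open import Data.Fin using (Fin; zero; suc; toℕ)
open import Data.Product using (_×_; Σ; ∃; ∃-syntax)
open import Data.Sum using (_⊎_)
open import Data.Empty using (⊥)
open import Data.Unit using (⊤)
open import Function.Definitions using (Injective)
open import Relation.Nullary using (¬_; Dec)
open import Relation.Binary.PropositionalEquality using (_≡_)
open import Function.Bundles using (_⇔_)
open import Level using (0ℓ)

record Graph : Set₁ where
  field
    n     : ℕ
    Adj   : Fin n → Fin n → Set
    irrefl : ∀ x → ¬ Adj x x
    sym    : ∀ x y → Adj x y → Adj y x
    dec    : ∀ x y → Dec (Adj x y)

module _ (G : Graph) where
  open Graph G

  V : Set
  V = Fin n

  IsClique : (V → Set) → Set
  IsClique P = ∀ x y → P x → P y → ¬ x ≡ y → Adj x y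

  AlphaNbhd≥3 : V → Set
  AlphaNbhd≥3 x = ∃[ a ] ∃[ b ] ∃[ c ]
      (Adj x a × Adj x b × Adj x c ×
       ¬ a ≡ b × ¬ a ≡ c × ¬ b ≡ c ×
       ¬ Adj a b × ¬ Adj a c × ¬ Adj b c)

  S : V → Set
  S = AlphaNbhd≥3

-- The graph T₀ on 9 vertices, numbered
-- 0 = p, 1 = p', 2 = q0, 3 = q1, 4 = q2, 5 = q3, 6 = r1, 7 = r2, 8 = r3.
-- Edges: pp', pq0, pq2, pq3, p'q1, p'q2, p'q3, q0r1, q1r1, q2r2, q3r3, r1r2, r1r3, r2r3.
T0Edge′ : ℕ → ℕ → Set
T0Edge′ 0 1 = ⊤
T0Edge′ 0 2 = ⊤
T0Edge′ 0 4 = ⊤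
T0Edge′ 0 5 = ⊤
T0Edge′ 1 3 = ⊤
T0Edge′ 1 4 = ⊤
T0Edge′ 1 5 = ⊤
T0Edge′ 2 6 = ⊤
T0Edge′ 3 6 = ⊤
T0Edge′ 4 7 = ⊤
T0Edge′ 5 8 = ⊤
T0Edge′ 6 7 = ⊤
T0Edge′ 6 8 = ⊤
T0Edge′ 7 8 = ⊤
T0Edge′ _ _ = ⊥

T0Edge : Fin 9 → Fin 9 → Set
T0Edge i j = T0Edge′ (toℕ i) (toℕ j)

T0Adj : Fin 9 → Fin 9 → Set
T0Adj i j = T0Edge i j ⊎ T0Edge j i

ContainsInducedT0 : Graph → Set
ContainsInducedT0 G = Σ (Fin 9 → Fin (Graph.n G)) λ f →
  Injective _≡_ _≡_ f × (∀ i j → (Graph.Adj G (f i) (f j) ⇔ T0Adj i j))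

T0Free : Graph → Set
T0Free G = ¬ ContainsInducedT0 G

{-# OPTIONS --safe #-}
module Submission where

open import Defs
open import Data.Nat using (_≥_)
open import Data.Fin using (Fin; #_)
open import Data.Product using (_×_; _,_; ∃-syntax)
open import Data.Sum using (inj₁; inj₂)
open import Data.Unit using (tt)
open import Function using (_∘_)
open import Function.Bundles using (_⇔_; Equivalence)
open import Function.Definitions using (Injective)
open import Relation.Nullary using (¬_)
open import Relation.Binary.PropositionalEquality using (_≡_)

-- In T₀ both p and r₁ have three pairwise nonadjacent neighbours (q₀, q₂, q₃ and
-- q₀, q₁, r₂), yet p and r₁ are distinct and nonadjacent. An induced copy of T₀
-- would therefore put two nonadjacent vertices into S.

IndependentNeighbourTriple : {W : Set} → (W → W → Set) → W → Set
IndependentNeighbourTriple R x = ∃[ a ] ∃[ b ] ∃[ c ]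
  (R x a × R x b × R x c ×
   ¬ a ≡ b × ¬ a ≡ c × ¬ b ≡ c ×
   ¬ R a b × ¬ R a c × ¬ R b c)

IsInducedEmbedding : {W : Set} (R : W → W → Set) (G : Graph) → (W → V G) → Set
IsInducedEmbedding R G f =
  Injective _≡_ _≡_ f × (∀ i j → Graph.Adj G (f i) (f j) ⇔ R i j)

embedded-triple⇒S : {W : Set} {R : W → W → Set} (G : Graph) {f : W → V G} →
  IsInducedEmbedding R G f → ∀ {x} → IndependentNeighbourTriple R x → S G (f x)
embedded-triple⇒S {R = R} G {f} (inj , iso)
  (a , b , c , xa , xb , xc , a≢b , a≢c , b≢c , ¬ab , ¬ac , ¬bc) =
  f a , f b , f c , adj xa , adj xb , adj xc ,
  a≢b ∘ inj , a≢c ∘ inj , b≢c ∘ inj ,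
  ¬ab ∘ reflect , ¬ac ∘ reflect , ¬bc ∘ reflect
  where
  adj : ∀ {i j} → R i j → Graph.Adj G (f i) (f j)
  adj {i} {j} = Equivalence.from (iso i j)
  reflect : ∀ {i j} → Graph.Adj G (f i) (f j) → R i j
  reflect {i} {j} = Equivalence.to (iso i j)

p q₀ q₁ q₂ q₃ r₁ r₂ : Fin 9
p  = # 0
q₀ = # 2
q₁ = # 3
q₂ = # 4
q₃ = # 5
r₁ = # 6
r₂ = # 7

p-triple : IndependentNeighbourTriple T0Adj p
p-triple = q₀ , q₂ , q₃ , inj₁ tt , inj₁ tt , inj₁ tt , (λ ()) , (λ ()) , (λ ()) ,
  (λ { (inj₁ ()) ; (inj₂ ()) }) , (λ { (inj₁ ()) ; (inj₂ ()) }) , (λ { (inj₁ ()) ; (inj₂ ()) })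

r₁-triple : IndependentNeighbourTriple T0Adj r₁
r₁-triple = q₀ , q₁ , r₂ , inj₂ tt , inj₂ tt , inj₁ tt , (λ ()) , (λ ()) , (λ ()) ,
  (λ { (inj₁ ()) ; (inj₂ ()) }) , (λ { (inj₁ ()) ; (inj₂ ()) }) , (λ { (inj₁ ()) ; (inj₂ ()) })

p≢r₁ : ¬ p ≡ r₁
p≢r₁ ()

p≁r₁ : ¬ T0Adj p r₁
p≁r₁ (inj₁ ())
p≁r₁ (inj₂ ())

proposition4p11 : (G : Graph) → Graph.n G ≥ 1 → IsClique G (S G) → T0Free G
proposition4p11 G _ S-clique (f , embedding@(inj , iso)) =
  p≁r₁ (Equivalence.to (iso p r₁) fp∼fr₁)
  where
  fp∼fr₁ : Graph.Adj G (f p) (f r₁)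
  fp∼fr₁ = S-clique (f p) (f r₁)
    (embedded-triple⇒S G embedding p-triple)
    (embedded-triple⇒S G embedding r₁-triple)
    (p≢r₁ ∘ inj)
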